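{- Let $n\in\mathbb{N}$. If $C=\{\mathbf{a},\mathbf{b},\mathbf{c},\mathbf{d}\}$ is a $2$-cap of size four in $\mathbb{F}_3^n$, then $D=\{\mathbf{a},\mathbf{b},\mathbf{c},\mathbf{d},\mathbf{a}+\mathbf{b}+\mathbf{c}+\mathbf{d}\}$ is a $2$-cap of size five.
   Context: $\mathbb{F}_3^n$ denotes $n$-dimensional affine space (vector space) over the field with three elements. A subset $C \subseteq \mathbb{F}_3^n$ is a $2$-cap if no three points of $C$ lie on a $1$-dimensional affine subspace and no four points of $C$ lie on a $2$-dimensional affine subspace (equivalently, every subset of $C$ of size at most $4$ is affinely independent). -}

module Defs where

open import Data.Nat using (ℕ; zero; suc; _≤_)
open import Data.Nat.DivMod using (_mod_)
open import Data.Fin using (Fin; toℕ)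
import Data.Nat as ℕ
open import Data.Product using (_×_)
open import Data.List using (List; _∷_; [])
open import Data.List.Membership.Propositional using (_∈_)
open import Data.List.Relation.Unary.Unique.Propositional using (Unique)
open import Function.Definitions using (Injective)
open import Relation.Binary.PropositionalEquality using (_≡_)

F₃ : Set
F₃ = Fin 3

infixl 6 _+₃_
infixl 7 _*₃_
infixl 6 _⊕_

_+₃_ : F₃ → F₃ → F₃
a +₃ b = (toℕ a ℕ.+ toℕ b) mod 3

_*₃_ : F₃ → F₃ → F₃
a *₃ b = (toℕ a ℕ.* toℕ b) mod 3

0₃ : F₃
0₃ = Fin.zero

Point : ℕ → Set
Point n = Fin n → F₃

_⊕_ : ∀ {n} → Point n → Point n → Point n
(x ⊕ y) j = x j +₃ y j

sum₃ : ∀ {k} → (Fin k → F₃) → F₃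
sum₃ {zero}  f = 0₃
sum₃ {suc k} f = f Fin.zero +₃ sum₃ (λ i → f (Fin.suc i))

AffinelyIndependent : ∀ {n k} → (Fin k → Point n) → Set
AffinelyIndependent {n} {k} p =
  (c : Fin k → F₃) →
  sum₃ c ≡ 0₃ →
  (∀ (j : Fin n) → sum₃ (λ i → c i *₃ p i j) ≡ 0₃) →
  ∀ i → c i ≡ 0₃

-- A subset C ⊆ 𝔽₃ⁿ (given as a predicate) is a 2-cap if every subset of C
-- of size at most 4 (i.e. every injective family of ≤ 4 points of C)
-- is affinely independent.
Is2Cap : ∀ {n} → (Point n → Set) → Set
Is2Cap {n} C =
  ∀ (k : ℕ) → k ≤ 4 → (p : Fin k → Point n) →
  Injective _≡_ _≡_ p → (∀ i → C (p i)) → AffinelyIndependent p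

setOf : ∀ {n} → List (Point n) → Point n → Set
setOf xs x = x ∈ xs

-- Every point of {a, b, c, d, a + b + c + d} is an affine combination of a, b, c, d, the
-- last one with coefficients (1, 1, 1, 1) summing to 4 = 1 in 𝔽₃.  An affine dependence W of
-- the five points therefore yields one of a, b, c, d, which is trivial; this forces W to be a
-- multiple of (1, 1, 1, 1, -1).  So every nonzero dependence of the five points has full
-- support, and any at most four of them form a proper subfamily with no nonzero dependence.
-- Two equal points would give a dependence supported on two indices, so the five points are
-- distinct as well.
module Submission where

open import Defs
open import Level using (Level; 0ℓ)
open import Relation.Binary.PropositionalEquality
  using (_≡_; _≢_; refl; sym; trans; cong; cong₂; module ≡-Reasoning)
open import Algebra.Bundles using (CommutativeSemiring)
open import Algebra.Structures {A = F₃} _≡_ using (IsCommutativeSemiring)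
open import Algebra.Structures.Biased {A = F₃} _≡_ using (isCommutativeSemiringˡ; isCommutativeMonoidˡ)
import Algebra.Properties.Semiring.Sum as SemiringSum
open import Data.Nat using (ℕ; zero; suc; _≤_; _<_; s<s; z<s)
open import Data.Nat.Properties using (≤-refl)
open import Data.Product using (_×_; _,_; proj₁; proj₂; ∃)
import Data.Product as Product
open import Data.List using (List; _∷_; []; lookup; length)
open import Data.List.Membership.Propositional.Properties using (∈-lookup)
import Data.List.Relation.Unary.All as All
import Data.List.Relation.Unary.Any as Any
open import Data.List.Relation.Unary.Any.Properties using (lookup-index)
open import Data.List.Relation.Unary.AllPairs using (_∷_)
open import Data.List.Relation.Unary.Unique.Propositional using (Unique)
open import Data.List.Relation.Unary.Unique.Propositional.Properties using (tabulate⁺)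
open import Data.Fin using (Fin; zero; suc; fromℕ; inject₁; _≟_)
open import Data.Fin.Properties using (all?; any?; ¬∀⟶∃¬; <⇒notInjective)
open import Data.Fin.Relation.Unary.Top using (View; view; ‵fromℕ; ‵inject₁)
open import Function using (_∘_; id; const)
open import Function.Definitions using (Injective)
open import Relation.Nullary using (¬_; yes; no; contradiction)
open import Relation.Nullary.Decidable using (from-yes)
open import Relation.Binary.PropositionalEquality.Algebra using (isMagma)

open ≡-Reasoning

1₃ 2₃ : F₃
1₃ = suc zero
2₃ = suc (suc zero)

F₃-isCommutativeSemiring : IsCommutativeSemiring _+₃_ _*₃_ 0₃ 1₃
F₃-isCommutativeSemiring = isCommutativeSemiringˡ record
  { +-isCommutativeMonoid = isCommutativeMonoidˡ record
    { isSemigroup = record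
      { isMagma = isMagma _+₃_
      ; assoc   = from-yes (all? λ x → all? λ y → all? λ z → x +₃ y +₃ z ≟ x +₃ (y +₃ z))
      }
    ; identityˡ = from-yes (all? λ x → 0₃ +₃ x ≟ x)
    ; comm      = from-yes (all? λ x → all? λ y → x +₃ y ≟ y +₃ x)
    }
  ; *-isCommutativeMonoid = isCommutativeMonoidˡ record
    { isSemigroup = record
      { isMagma = isMagma _*₃_
      ; assoc   = from-yes (all? λ x → all? λ y → all? λ z → x *₃ y *₃ z ≟ x *₃ (y *₃ z))
      }
    ; identityˡ = from-yes (all? λ x → 1₃ *₃ x ≟ x)
    ; comm      = from-yes (all? λ x → all? λ y → x *₃ y ≟ y *₃ x)
    }
  ; distribʳ = from-yes (all? λ x → all? λ y → all? λ z → (y +₃ z) *₃ x ≟ y *₃ x +₃ z *₃ x)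
  ; zeroˡ    = from-yes (all? λ x → 0₃ *₃ x ≟ 0₃)
  }

F₃-commutativeSemiring : CommutativeSemiring 0ℓ 0ℓ
F₃-commutativeSemiring = record { isCommutativeSemiring = F₃-isCommutativeSemiring }

open CommutativeSemiring F₃-commutativeSemiring
  using (+-identityˡ; +-identityʳ; *-identityʳ; zeroʳ; *-comm; *-assoc; distribˡ)
open SemiringSum (CommutativeSemiring.semiring F₃-commutativeSemiring)
  using (sum; sum-cong-≗; sum-replicate-zero; ∑-distrib-+; ∑-comm; *-distribˡ-sum; *-distribʳ-sum)

sum₃≡sum : ∀ {k} (f : Fin k → F₃) → sum₃ f ≡ sum f
sum₃≡sum {zero}  f = refl
sum₃≡sum {suc k} f = cong (f zero +₃_) (sum₃≡sum (f ∘ suc))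

⟨_,_⟩ : ∀ {k} → (Fin k → F₃) → (Fin k → F₃) → F₃
⟨ v , f ⟩ = sum (λ i → v i *₃ f i)

module _ {k : ℕ} where

  ⟨,⟩-comm : (u v : Fin k → F₃) → ⟨ u , v ⟩ ≡ ⟨ v , u ⟩
  ⟨,⟩-comm u v = sum-cong-≗ (λ i → *-comm (u i) (v i))

  ⟨,⟩-zeroʳ : (v : Fin k → F₃) {f : Fin k → F₃} → (∀ i → f i ≡ 0₃) → ⟨ v , f ⟩ ≡ 0₃
  ⟨,⟩-zeroʳ v f≡0 =
    trans (sum-cong-≗ (λ i → trans (cong (v i *₃_) (f≡0 i)) (zeroʳ (v i)))) (sum-replicate-zero k)

  ⟨,⟩-distribʳ : (v f g : Fin k → F₃) → ⟨ v , (λ i → f i +₃ g i) ⟩ ≡ ⟨ v , f ⟩ +₃ ⟨ v , g ⟩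
  ⟨,⟩-distribʳ v f g =
    trans (sum-cong-≗ (λ i → distribˡ (v i) (f i) (g i))) (∑-distrib-+ (λ i → v i *₃ f i) (λ i → v i *₃ g i))

  ⟨,1⟩ : (v : Fin k → F₃) → ⟨ v , const 1₃ ⟩ ≡ sum v
  ⟨,1⟩ v = sum-cong-≗ (λ i → *-identityʳ (v i))

δ : ∀ {k} → Fin k → Fin k → F₃
δ zero    zero    = 1₃
δ zero    (suc _) = 0₃
δ (suc _) zero    = 0₃
δ (suc s) (suc t) = δ s t

δ-diag : ∀ {k} (s : Fin k) → δ s s ≡ 1₃
δ-diag zero    = refl
δ-diag (suc s) = δ-diag s

δ-off : ∀ {k} {s t : Fin k} → s ≢ t → δ s t ≡ 0₃
δ-off {s = zero}  {zero}  s≢t = contradiction refl s≢t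
δ-off {s = zero}  {suc t} s≢t = refl
δ-off {s = suc s} {zero}  s≢t = refl
δ-off {s = suc s} {suc t} s≢t = δ-off (s≢t ∘ cong suc)

δ-sym : ∀ {k} (s t : Fin k) → δ s t ≡ δ t s
δ-sym zero    zero    = refl
δ-sym zero    (suc t) = refl
δ-sym (suc s) zero    = refl
δ-sym (suc s) (suc t) = δ-sym s t

δ-injective : ∀ {k l} {σ : Fin k → Fin l} → Injective _≡_ _≡_ σ → ∀ s t → δ (σ s) (σ t) ≡ δ s t
δ-injective {σ = σ} σ-inj s t with s ≟ t
... | yes refl = trans (δ-diag (σ s)) (sym (δ-diag s))
... | no s≢t   = trans (δ-off (s≢t ∘ σ-inj)) (sym (δ-off s≢t))

⟨,δ⟩ : ∀ {k} (v : Fin k → F₃) (t : Fin k) → ⟨ v , (λ s → δ s t) ⟩ ≡ v t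
⟨,δ⟩ v zero = begin
  v zero *₃ 1₃ +₃ ⟨ v ∘ suc , const 0₃ ⟩
    ≡⟨ cong₂ _+₃_ (*-identityʳ (v zero)) (⟨,⟩-zeroʳ (v ∘ suc) (λ _ → refl)) ⟩
  v zero +₃ 0₃
    ≡⟨ +-identityʳ (v zero) ⟩
  v zero
    ∎
⟨,δ⟩ v (suc t) = begin
  v zero *₃ 0₃ +₃ ⟨ v ∘ suc , (λ s → δ s t) ⟩
    ≡⟨ cong₂ _+₃_ (zeroʳ (v zero)) (⟨,δ⟩ (v ∘ suc) t) ⟩
  0₃ +₃ v (suc t)
    ≡⟨ +-identityˡ (v (suc t)) ⟩
  v (suc t)
    ∎

⟨δ,⟩ : ∀ {k} (s : Fin k) (f : Fin k → F₃) → ⟨ δ s , f ⟩ ≡ f s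
⟨δ,⟩ s f = begin
  ⟨ δ s , f ⟩            ≡⟨ ⟨,⟩-comm (δ s) f ⟩
  ⟨ f , δ s ⟩            ≡⟨ sum-cong-≗ (λ t → cong (f t *₃_) (δ-sym s t)) ⟩
  ⟨ f , (λ t → δ t s) ⟩  ≡⟨ ⟨,δ⟩ f s ⟩
  f s                    ∎

infixl 7 _·_

_·_ : ∀ {k l} → (Fin k → F₃) → (Fin k → Fin l → F₃) → Fin l → F₃
(w · M) s = ⟨ w , (λ i → M i s) ⟩

⟨·,⟩ : ∀ {k l} (w : Fin k → F₃) (M : Fin k → Fin l → F₃) (f : Fin l → F₃) →
       ⟨ w · M , f ⟩ ≡ ⟨ w , (λ i → ⟨ M i , f ⟩) ⟩
⟨·,⟩ w M f = begin
  sum (λ s → sum (λ i → w i *₃ M i s) *₃ f s)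
    ≡⟨ sum-cong-≗ (λ s → *-distribʳ-sum (f s) (λ i → w i *₃ M i s)) ⟩
  sum (λ s → sum (λ i → w i *₃ M i s *₃ f s))
    ≡⟨ ∑-comm (λ i s → w i *₃ M i s *₃ f s) ⟨
  sum (λ i → sum (λ s → w i *₃ M i s *₃ f s))
    ≡⟨ sum-cong-≗ (λ i → sum-cong-≗ (λ s → *-assoc (w i) (M i s) (f s))) ⟩
  sum (λ i → sum (λ s → w i *₃ (M i s *₃ f s)))
    ≡⟨ sum-cong-≗ (λ i → *-distribˡ-sum (w i) (λ s → M i s *₃ f s)) ⟨
  sum (λ i → w i *₃ ⟨ M i , f ⟩)
    ∎

record AffineDependence {n k} (p : Fin k → Point n) (w : Fin k → F₃) : Set where
  constructor affineDependence
  field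
    weights-sum≡0  : sum w ≡ 0₃
    combination≡0 : ∀ j → ⟨ w , (λ i → p i j) ⟩ ≡ 0₃

module _ {n k : ℕ} {p : Fin k → Point n} where

  AffinelyIndependent⇒trivial : AffinelyIndependent p →
    ∀ {w} → AffineDependence p w → ∀ i → w i ≡ 0₃
  AffinelyIndependent⇒trivial indep {w} (affineDependence Σw≡0 Σwp≡0) =
    indep w (trans (sum₃≡sum w) Σw≡0) (λ j → trans (sum₃≡sum (λ i → w i *₃ p i j)) (Σwp≡0 j))

  trivial⇒AffinelyIndependent : (∀ w → AffineDependence p w → ∀ i → w i ≡ 0₃) →
    AffinelyIndependent p
  trivial⇒AffinelyIndependent trivial w Σw≡0 Σwp≡0 =
    trivial w (affineDependence (trans (sym (sum₃≡sum w)) Σw≡0)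
                                λ j → trans (sym (sum₃≡sum (λ i → w i *₃ p i j))) (Σwp≡0 j))

AffinelyIndependent-cong : ∀ {n k} {p p′ : Fin k → Point n} → (∀ i → p i ≡ p′ i) →
  AffinelyIndependent p′ → AffinelyIndependent p
AffinelyIndependent-cong p≗p′ indep = trivial⇒AffinelyIndependent λ w (affineDependence Σw≡0 Σwp≡0) →
  AffinelyIndependent⇒trivial indep (affineDependence Σw≡0 λ j →
    trans (sum-cong-≗ (λ i → cong (λ x → w i *₃ x j) (sym (p≗p′ i)))) (Σwp≡0 j))

record AffineCombinations {n k l}
    (M : Fin k → Fin l → F₃) (q : Fin l → Point n) (p : Fin k → Point n) : Set where
  field
    rows-sum≡1 : ∀ i → sum (M i) ≡ 1₃
    expansion  : ∀ i j → p i j ≡ ⟨ M i , (λ s → q s j) ⟩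

open AffineCombinations

AffineDependence-· : ∀ {n k l} {M : Fin k → Fin l → F₃} {q : Fin l → Point n} {p : Fin k → Point n} →
  AffineCombinations M q p → ∀ {w} → AffineDependence p w → AffineDependence q (w · M)
AffineDependence-· {M = M} {q} {p} comb {w} (affineDependence Σw≡0 Σwp≡0) =
  affineDependence Σw·M≡0 λ j → begin
    ⟨ w · M , (λ s → q s j) ⟩               ≡⟨ ⟨·,⟩ w M (λ s → q s j) ⟩
    ⟨ w , (λ i → ⟨ M i , (λ s → q s j) ⟩) ⟩ ≡⟨ sum-cong-≗ (λ i → cong (w i *₃_) (expansion comb i j)) ⟨
    ⟨ w , (λ i → p i j) ⟩                   ≡⟨ Σwp≡0 j ⟩
    0₃                                      ∎
  where
  row-sum : ∀ i → ⟨ M i , const 1₃ ⟩ ≡ 1₃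
  row-sum i = trans (⟨,1⟩ (M i)) (rows-sum≡1 comb i)
  Σw·M≡0 : sum (w · M) ≡ 0₃
  Σw·M≡0 = begin
    sum (w · M)                       ≡⟨ ⟨,1⟩ (w · M) ⟨
    ⟨ w · M , const 1₃ ⟩              ≡⟨ ⟨·,⟩ w M (const 1₃) ⟩
    ⟨ w , (λ i → ⟨ M i , const 1₃ ⟩) ⟩ ≡⟨ sum-cong-≗ (λ i → cong (w i *₃_) (row-sum i)) ⟩
    ⟨ w , const 1₃ ⟩                  ≡⟨ ⟨,1⟩ w ⟩
    sum w                             ≡⟨ Σw≡0 ⟩
    0₃                                ∎

AffineCombinations-∘ : ∀ {n k l} (q : Fin l → Point n) (σ : Fin k → Fin l) →
  AffineCombinations (δ ∘ σ) q (q ∘ σ)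
AffineCombinations-∘ q σ = record
  { rows-sum≡1 = λ i → trans (sym (⟨,1⟩ (δ (σ i)))) (⟨δ,⟩ (σ i) (const 1₃))
  ; expansion  = λ i j → sym (⟨δ,⟩ (σ i) (λ s → q s j))
  }

·δ∘-outside : ∀ {k l} (w : Fin k → F₃) {σ : Fin k → Fin l} {s} →
  (∀ i → σ i ≢ s) → (w · (δ ∘ σ)) s ≡ 0₃
·δ∘-outside w s∉σ = ⟨,⟩-zeroʳ w (λ i → δ-off (s∉σ i))

·δ∘-injective : ∀ {k l} (w : Fin k → F₃) {σ : Fin k → Fin l} → Injective _≡_ _≡_ σ →
  ∀ i → (w · (δ ∘ σ)) (σ i) ≡ w i
·δ∘-injective w σ-inj i =
  trans (sum-cong-≗ (λ i′ → cong (w i′ *₃_) (δ-injective σ-inj i′ i))) (⟨,δ⟩ w i)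

<⇒notSurjective : ∀ {k l} → k < l → (σ : Fin k → Fin l) → ∃ λ s → ∀ i → σ i ≢ s
<⇒notSurjective {l = l} k<l σ =
  Product.map id (λ s∉σ i σi≡s → s∉σ (i , σi≡s))
    (¬∀⟶∃¬ l _ (λ s → any? (λ i → σ i ≟ s)) σ-notOnto)
  where
  σ-notOnto : ¬ (∀ s → ∃ λ i → σ i ≡ s)
  σ-notOnto onto = <⇒notInjective {f = proj₁ ∘ onto} k<l λ {s} {t} eq →
    trans (sym (proj₂ (onto s))) (trans (cong σ eq) (proj₂ (onto t)))

DependencesHaveFullSupport : ∀ {n l} → (Fin l → Point n) → Set
DependencesHaveFullSupport q = ∀ w → AffineDependence q w → ∀ s → w s ≡ 0₃ → ∀ t → w t ≡ 0₃

module _ {n l : ℕ} {q : Fin l → Point n} (full : DependencesHaveFullSupport q) where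

  ·δ∘-vanishes : ∀ {k} → k < l → (σ : Fin k → Fin l) →
    ∀ {w} → AffineDependence (q ∘ σ) w → ∀ s → (w · (δ ∘ σ)) s ≡ 0₃
  ·δ∘-vanishes k<l σ {w} dep with s , s∉σ ← <⇒notSurjective k<l σ =
    full (w · (δ ∘ σ)) (AffineDependence-· (AffineCombinations-∘ q σ) dep) s (·δ∘-outside w s∉σ)

  properSubfamily-independent : ∀ {k} → k < l → {σ : Fin k → Fin l} → Injective _≡_ _≡_ σ →
    AffinelyIndependent (q ∘ σ)
  properSubfamily-independent k<l {σ} σ-inj = trivial⇒AffinelyIndependent λ w dep i →
    trans (sym (·δ∘-injective w σ-inj i)) (·δ∘-vanishes k<l σ dep (σ i))

  -- Two equal points q s = q t carry the dependence (1, 2), since 1 + 2 = 0 in 𝔽₃.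
  fullSupport⇒injective : 2 < l → Injective _≡_ _≡_ q
  fullSupport⇒injective 2<l {s} {t} qs≡qt with s ≟ t
  ... | yes s≡t = s≡t
  ... | no  s≢t = contradiction (trans (sym weight-s) (·δ∘-vanishes 2<l σ {w} dep s)) λ ()
    where
    σ : Fin 2 → Fin l
    σ = lookup (s ∷ t ∷ [])
    w : Fin 2 → F₃
    w = lookup (1₃ ∷ 2₃ ∷ [])
    x+2x≡0 : ∀ x → 1₃ *₃ x +₃ (2₃ *₃ x +₃ 0₃) ≡ 0₃
    x+2x≡0 = from-yes (all? λ x → 1₃ *₃ x +₃ (2₃ *₃ x +₃ 0₃) ≟ 0₃)
    dep : AffineDependence (q ∘ σ) w
    dep = affineDependence refl λ j →
      trans (cong (λ y → 1₃ *₃ q s j +₃ (2₃ *₃ y +₃ 0₃)) (cong (λ x → x j) (sym qs≡qt))) (x+2x≡0 (q s j))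
    weight-s : (w · (δ ∘ σ)) s ≡ 1₃
    weight-s = cong₂ (λ x y → 1₃ *₃ x +₃ (2₃ *₃ y +₃ 0₃)) (δ-diag s) (δ-off (s≢t ∘ sym))

module _ {a : Level} {A : Set a} where

  lookup-injective : {xs : List A} → Unique xs → Injective _≡_ _≡_ (lookup xs)
  lookup-injective (x∉xs ∷ _) {zero}  {zero}  _  = refl
  lookup-injective (x∉xs ∷ _) {zero}  {suc j} eq = contradiction eq (All.lookup x∉xs (∈-lookup j))
  lookup-injective (x∉xs ∷ _) {suc i} {zero}  eq = contradiction (sym eq) (All.lookup x∉xs (∈-lookup i))
  lookup-injective (_ ∷ xs-unique) {suc i} {suc j} eq = cong suc (lookup-injective xs-unique eq)

Is2Cap-setOf : ∀ {n} (xs : List (Point n)) →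
  (∀ k → k ≤ 4 → (σ : Fin k → Fin (length xs)) → Injective _≡_ _≡_ σ →
     AffinelyIndependent (lookup xs ∘ σ)) →
  Is2Cap (setOf xs)
Is2Cap-setOf xs indep k k≤4 p p-inj p∈xs = AffinelyIndependent-cong p≡xsσ (indep k k≤4 σ σ-inj)
  where
  σ : Fin k → Fin (length xs)
  σ i = Any.index (p∈xs i)
  p≡xsσ : ∀ i → p i ≡ lookup xs (σ i)
  p≡xsσ i = lookup-index (p∈xs i)
  σ-inj : Injective _≡_ _≡_ σ
  σ-inj {i} {i′} eq = p-inj (trans (p≡xsσ i) (trans (cong (lookup xs) eq) (sym (p≡xsσ i′))))

-- Row s writes the s-th point of x, y, z, w, x + y + z + w in terms of x, y, z, w.
expandSum : Fin 5 → Fin 4 → F₃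
expandSum s m = δ s (inject₁ m) +₃ δ s (fromℕ 4)

-- The last row sums to 4 = 1: this is where the characteristic 3 enters.
expandSum-affine : ∀ s → sum (expandSum s) ≡ 1₃
expandSum-affine = from-yes (all? λ s → sum (expandSum s) ≟ 1₃)

expandSum-expands : ∀ s x y z w →
  lookup (x ∷ y ∷ z ∷ w ∷ x +₃ y +₃ z +₃ w ∷ []) s
    ≡ ⟨ expandSum s , lookup (x ∷ y ∷ z ∷ w ∷ []) ⟩
expandSum-expands = from-yes (all? λ s → all? λ x → all? λ y → all? λ z → all? λ w →
  lookup (x ∷ y ∷ z ∷ w ∷ x +₃ y +₃ z +₃ w ∷ []) s ≟ ⟨ expandSum s , lookup (x ∷ y ∷ z ∷ w ∷ []) ⟩)

·expandSum : ∀ W m → (W · expandSum) m ≡ W (inject₁ m) +₃ W (fromℕ 4)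
·expandSum W m = trans (⟨,⟩-distribʳ W (λ s → δ s (inject₁ m)) (λ s → δ s (fromℕ 4)))
                       (cong₂ _+₃_ (⟨,δ⟩ W (inject₁ m)) (⟨,δ⟩ W (fromℕ 4)))

module SumExtension {n : ℕ} (a b c d : Point n) where

  C D : List (Point n)
  C = a ∷ b ∷ c ∷ d ∷ []
  D = a ∷ b ∷ c ∷ d ∷ a ⊕ b ⊕ c ⊕ d ∷ []

  sumExtension-combinations : AffineCombinations expandSum (lookup C) (lookup D)
  sumExtension-combinations = record { rows-sum≡1 = expandSum-affine ; expansion = expands }
    where
    expands : ∀ s j → lookup D s j ≡ ⟨ expandSum s , (λ m → lookup C m j) ⟩
    expands zero                         j = expandSum-expands zero (a j) (b j) (c j) (d j)
    expands (suc zero)                   j = expandSum-expands (suc zero) (a j) (b j) (c j) (d j)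
    expands (suc (suc zero))             j = expandSum-expands (suc (suc zero)) (a j) (b j) (c j) (d j)
    expands (suc (suc (suc zero)))       j = expandSum-expands (suc (suc (suc zero))) (a j) (b j) (c j) (d j)
    expands (suc (suc (suc (suc zero)))) j = expandSum-expands (fromℕ 4) (a j) (b j) (c j) (d j)

  -- W · expandSum is a dependence of a, b, c, d, hence zero: W m = - W 4 for all m < 4.
  sumExtension-fullSupport : AffinelyIndependent (lookup C) →
    DependencesHaveFullSupport (lookup D)
  sumExtension-fullSupport indep W dep s Ws≡0 t = W-vanishes (view t)
    where
    Wm+W4≡0 : ∀ m → W (inject₁ m) +₃ W (fromℕ 4) ≡ 0₃
    Wm+W4≡0 m = trans (sym (·expandSum W m))
      (AffinelyIndependent⇒trivial indep (AffineDependence-· sumExtension-combinations dep) m)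
    W4≡0 : ∀ {r} → View r → W r ≡ 0₃ → W (fromℕ 4) ≡ 0₃
    W4≡0 ‵fromℕ       W4≡0′ = W4≡0′
    W4≡0 (‵inject₁ m) Wm≡0  = begin
      W (fromℕ 4)                   ≡⟨ +-identityˡ (W (fromℕ 4)) ⟨
      0₃ +₃ W (fromℕ 4)             ≡⟨ cong (_+₃ W (fromℕ 4)) Wm≡0 ⟨
      W (inject₁ m) +₃ W (fromℕ 4)  ≡⟨ Wm+W4≡0 m ⟩
      0₃                            ∎
    W-vanishes : ∀ {t} → View t → W t ≡ 0₃
    W-vanishes ‵fromℕ       = W4≡0 (view s) Ws≡0
    W-vanishes (‵inject₁ m) = begin
      W (inject₁ m)                 ≡⟨ +-identityʳ (W (inject₁ m)) ⟨
      W (inject₁ m) +₃ 0₃           ≡⟨ cong (W (inject₁ m) +₃_) (W4≡0 (view s) Ws≡0) ⟨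
      W (inject₁ m) +₃ W (fromℕ 4)  ≡⟨ Wm+W4≡0 m ⟩
      0₃                            ∎

lemma3p8 : (n : ℕ) (a b c d : Point n) →
    Unique (a ∷ b ∷ c ∷ d ∷ []) →
    Is2Cap (setOf (a ∷ b ∷ c ∷ d ∷ [])) →
    Unique (a ∷ b ∷ c ∷ d ∷ (a ⊕ b ⊕ c ⊕ d) ∷ [])
      × Is2Cap (setOf (a ∷ b ∷ c ∷ d ∷ (a ⊕ b ⊕ c ⊕ d) ∷ []))
lemma3p8 n a b c d C-unique C-cap =
  tabulate⁺ (fullSupport⇒injective {q = lookup D} D-full (s<s (s<s z<s))) ,
  Is2Cap-setOf D (λ k k≤4 σ σ-inj → properSubfamily-independent {q = lookup D} D-full (s<s k≤4) σ-inj)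
  where
  open SumExtension a b c d
  D-full : DependencesHaveFullSupport (lookup D)
  D-full = sumExtension-fullSupport (C-cap 4 ≤-refl (lookup C) (lookup-injective C-unique) ∈-lookup)
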